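{- Let $r \ge 3$, let $t$ be a real number and let $G$ be a tournament with $r+1$ vertices. If $D^*(G) < t$, then $G$ is an extension of some tournament $G'$ on $r$ vertices with $D^*(G') < t\cdot\frac{r-1}{r+1}$.
   Context: For a tournament $G$, a fractional triangle decomposition is a function $f$ from the 3-vertex subsets of $V(G)$ to $[0,1]$ such that for each pair of vertices the sum of $f$ over 3-sets containing the pair equals $1$. $D^*(G)$ is the maximum, over all fractional triangle decompositions $f$ of $G$, of the sum of $f$ over the 3-sets inducing a transitive triangle $T_3$. A tournament $G$ on $r+1$ vertices is an extension of a tournament $G'$ on $r$ vertices if $G'$ is a subgraph of $G$.
   Formalization: The number t is rational rather than real, and the fractional triangle decompositions f take rational values in [0,1]. -}

module Defs where

open import Data.Nat as ℕ using (ℕ; suc; _∸_)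
open import Data.Fin using (Fin; toℕ)
open import Data.Fin.Properties using (_<?_)
open import Data.Bool using (Bool; true; false; not; _∧_; _∨_; if_then_else_)
open import Data.List using (List; []; _∷_; allFin; concatMap; filter; map; foldr)
open import Data.Product using (_×_; _,_; Σ; ∃)
open import Data.Integer using (+_)
open import Data.Rational using (ℚ; 0ℚ; 1ℚ; _+_; _*_; _/_; _<_; _≤_)
open import Relation.Nullary.Decidable using (⌊_⌋; _×-dec_)
open import Data.List.Membership.Propositional using (_∈_)
import Data.Fin as F
import Data.Bool as B
open import Relation.Binary.PropositionalEquality using (_≡_; _≢_)
open import Function.Definitions using (Injective)

record Tournament (n : ℕ) : Set where
  field
    arc     : Fin n → Fin n → Bool
    irrefl  : ∀ i → arc i i ≡ false
    tourn   : ∀ i j → i ≢ j → arc i j ≡ not (arc j i)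
open Tournament public

_<ᵇ_ : ∀ {n} → Fin n → Fin n → Bool
i <ᵇ j = ⌊ i <? j ⌋

_==ᵇ_ : ∀ {n} → Fin n → Fin n → Bool
i ==ᵇ j = ⌊ i F.≟ j ⌋

-- The 3-vertex subsets of Fin n, each listed once as (i , j , k) with i < j < k.
Triple : ℕ → Set
Triple n = Fin n × Fin n × Fin n

triples : (n : ℕ) → List (Triple n)
triples n =
  filter (λ { (i , j , k) → (i <? j) ×-dec (j <? k) })
    (concatMap (λ i → concatMap (λ j → map (λ k → (i , j , k)) (allFin n)) (allFin n)) (allFin n))

contains : ∀ {n} → Fin n → Fin n → Triple n → Bool
contains a b (i , j , k) = (a ==ᵇ i ∨ a ==ᵇ j ∨ a ==ᵇ k) ∧ (b ==ᵇ i ∨ b ==ᵇ j ∨ b ==ᵇ k)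

sumℚ : List ℚ → ℚ
sumℚ = foldr _+_ 0ℚ

-- A weight function on 3-sets (only its values on `triples n` matter).
Weight : ℕ → Set
Weight n = Triple n → ℚ

IsFracTriDecomp : (n : ℕ) → Weight n → Set
IsFracTriDecomp n f =
  (∀ (x : Triple n) → x ∈ triples n → 0ℚ ≤ f x × f x ≤ 1ℚ)
  × (∀ (a b : Fin n) → a F.< b →
       sumℚ (map f (filter (λ x → B._≟_ (contains a b x) true) (triples n))) ≡ 1ℚ)

beats2 : ∀ {n} → Tournament n → Fin n → Fin n → Fin n → Bool
beats2 G v x y = arc G v x ∧ arc G v y

isTransitive : ∀ {n} → Tournament n → Triple n → Bool
isTransitive G (i , j , k) = beats2 G i j k ∨ beats2 G j i k ∨ beats2 G k i j

transValue : ∀ {n} → Tournament n → Weight n → ℚ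
transValue {n} G f = sumℚ (map f (filter (λ x → B._≟_ (isTransitive G x) true) (triples n)))

-- "D*(G) < t": every fractional triangle decomposition has transitive value < t.
-- (D*(G) is a maximum of an LP with rational data; it is attained at a rational
-- point, so this is equivalent to max < t.)
DStar<_ : ∀ {n} → Tournament n → ℚ → Set
DStar<_ {n} G t = ∀ (f : Weight n) → IsFracTriDecomp n f → transValue G f < t

IsExtensionOf : ∀ {r} → Tournament (suc r) → Tournament r → Set
IsExtensionOf {r} G G' =
  Σ (Fin r → Fin (suc r)) λ φ → Injective _≡_ _≡_ φ × (∀ i j → arc G' i j ≡ arc G (φ i) (φ j))

module Submission where

-- If every vertex-deleted subtournament G − v had a fractional triangle decomposition f_v of
-- transitive value at least s = t(r−1)/(r+1), then extending each f_v by zero to G and taking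
-- (1/(r−1)) Σ_v f_v would give a fractional triangle decomposition of G, because each pair of
-- vertices survives in exactly r − 1 of the r + 1 deletions; its transitive value would be at
-- least (r+1)s/(r−1) = t, contradicting D*(G) < t.  To exhibit such a v constructively, note that
-- the existence of a decomposition of G − v with transitive value ≥ s is the feasibility of a
-- finite system of linear inequalities over ℚ, which Fourier–Motzkin elimination decides.

module Sums where

  open import Defs using (sumℚ)
  open import Data.Bool using (if_then_else_)
  open import Data.Bool.Properties using (if-eta)
  open import Data.Fin as Fin using (Fin; punchIn; punchOut)
  open import Data.Fin.Properties using (punchIn-punchOut)
  open import Data.Integer using (+_)
  import Data.Integer as ℤ
  import Data.Integer.Properties as ℤ
  open import Data.List using (List; []; _∷_; _++_; map; concatMap; filter; allFin)
  open import Data.List.Membership.Propositional using (_∈_)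
  open import Data.List.Properties using (map-tabulate)
  open import Data.List.Relation.Unary.Any using (here; there)
  open import Data.Nat using (ℕ; zero; suc)
  import Data.Nat.Properties as ℕ
  open import Data.Rational using (ℚ; 0ℚ; 1ℚ; _+_; _*_; _/_; _≤_; toℚᵘ)
  open import Data.Rational.Properties
  open import Data.Rational.Solver using (module +-*-Solver)
  import Data.Rational.Unnormalised as ℚᵘ
  import Data.Rational.Unnormalised.Properties as ℚᵘ
  open import Function using (id; _∘_)
  open import Relation.Binary.PropositionalEquality
  open import Relation.Nullary using (Dec; does; yes; no)
  open +-*-Solver

  ∑ : {A : Set} → List A → (A → ℚ) → ℚ
  ∑ xs g = sumℚ (map g xs)

  syntax ∑ xs (λ x → e) = ∑[ x ∈ xs ] e

  module _ {A : Set} where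

    ∑-++ : ∀ (xs ys : List A) g → ∑ (xs ++ ys) g ≡ ∑ xs g + ∑ ys g
    ∑-++ []       ys g = sym (+-identityˡ _)
    ∑-++ (x ∷ xs) ys g = trans (cong (_+_ (g x)) (∑-++ xs ys g)) (sym (+-assoc (g x) _ _))

    ∑-cong : ∀ (xs : List A) {f g : A → ℚ} → (∀ x → f x ≡ g x) → ∑ xs f ≡ ∑ xs g
    ∑-cong []       f≗g = refl
    ∑-cong (x ∷ xs) f≗g = cong₂ _+_ (f≗g x) (∑-cong xs f≗g)

    ∑-zero : ∀ (xs : List A) → ∑[ x ∈ xs ] 0ℚ ≡ 0ℚ
    ∑-zero []       = refl
    ∑-zero (x ∷ xs) = trans (+-identityˡ _) (∑-zero xs)

    ∑-+ : ∀ (xs : List A) f g → ∑[ x ∈ xs ] (f x + g x) ≡ ∑ xs f + ∑ xs g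
    ∑-+ []       f g = refl
    ∑-+ (x ∷ xs) f g = trans (cong (_+_ (f x + g x)) (∑-+ xs f g))
      (solve 4 (λ a b c d → (a :+ b) :+ (c :+ d) := (a :+ c) :+ (b :+ d)) refl (f x) (g x) (∑ xs f) (∑ xs g))

    ∑-*ˡ : ∀ (xs : List A) c f → ∑[ x ∈ xs ] (c * f x) ≡ c * ∑ xs f
    ∑-*ˡ []       c f = sym (*-zeroʳ c)
    ∑-*ˡ (x ∷ xs) c f = trans (cong (_+_ (c * f x)) (∑-*ˡ xs c f)) (sym (*-distribˡ-+ c (f x) _))

    ∑-*ʳ : ∀ (xs : List A) f c → ∑[ x ∈ xs ] (f x * c) ≡ ∑ xs f * c
    ∑-*ʳ xs f c = trans (∑-cong xs (λ x → *-comm (f x) c)) (trans (∑-*ˡ xs c f) (*-comm c _))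

    ∑-mono-≤ : ∀ (xs : List A) {f g : A → ℚ} → (∀ x → x ∈ xs → f x ≤ g x) → ∑ xs f ≤ ∑ xs g
    ∑-mono-≤ []       f≤g = ≤-refl
    ∑-mono-≤ (x ∷ xs) f≤g = +-mono-≤ (f≤g x (here refl)) (∑-mono-≤ xs (λ y y∈xs → f≤g y (there y∈xs)))

    ∑-nonNeg : ∀ (xs : List A) {f : A → ℚ} → (∀ x → x ∈ xs → 0ℚ ≤ f x) → 0ℚ ≤ ∑ xs f
    ∑-nonNeg xs {f} 0≤f = subst (_≤ ∑ xs f) (∑-zero xs) (∑-mono-≤ xs 0≤f)

    ∈⇒≤∑ : ∀ {xs : List A} {x} g → (∀ y → 0ℚ ≤ g y) → x ∈ xs → g x ≤ ∑ xs g
    ∈⇒≤∑ {x ∷ xs} g g≥0 (here refl) =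
      subst (_≤ g x + ∑ xs g) (+-identityʳ (g x)) (+-monoʳ-≤ (g x) (∑-nonNeg xs (λ y _ → g≥0 y)))
    ∈⇒≤∑ {y ∷ xs} g g≥0 (there x∈xs) =
      ≤-trans (∈⇒≤∑ g g≥0 x∈xs) (subst (_≤ g y + ∑ xs g) (+-identityˡ (∑ xs g)) (+-monoˡ-≤ (∑ xs g) (g≥0 y)))

  if-vanishing : ∀ b {x} → x ≡ 0ℚ → (if b then x else 0ℚ) ≡ 0ℚ
  if-vanishing b refl = if-eta b

  ∑-swap : ∀ {A B : Set} (xs : List A) (ys : List B) (f : A → B → ℚ) →
           ∑[ x ∈ xs ] ∑[ y ∈ ys ] f x y ≡ ∑[ y ∈ ys ] ∑[ x ∈ xs ] f x y
  ∑-swap []       ys f = sym (∑-zero ys)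
  ∑-swap (x ∷ xs) ys f = trans (cong (_+_ (∑ ys (f x))) (∑-swap xs ys f)) (sym (∑-+ ys (f x) _))

  ∑-map : ∀ {A B : Set} (h : A → B) (xs : List A) g → ∑ (map h xs) g ≡ ∑[ x ∈ xs ] g (h x)
  ∑-map h []       g = refl
  ∑-map h (x ∷ xs) g = cong (_+_ (g (h x))) (∑-map h xs g)

  ∑-concatMap : ∀ {A B : Set} (h : A → List B) (xs : List A) g → ∑ (concatMap h xs) g ≡ ∑[ x ∈ xs ] ∑ (h x) g
  ∑-concatMap h []       g = refl
  ∑-concatMap h (x ∷ xs) g = trans (∑-++ (h x) _ g) (cong (_+_ (∑ (h x) g)) (∑-concatMap h xs g))

  ∑-filter : ∀ {A : Set} {P : A → Set} (P? : ∀ x → Dec (P x)) (xs : List A) g →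
             ∑ (filter P? xs) g ≡ ∑[ x ∈ xs ] (if does (P? x) then g x else 0ℚ)
  ∑-filter P? []       g = refl
  ∑-filter P? (x ∷ xs) g with P? x
  ... | yes _ = cong (_+_ (g x)) (∑-filter P? xs g)
  ... | no  _ = trans (∑-filter P? xs g) (sym (+-identityˡ _))

  ∑-allFin-suc : ∀ n (h : Fin (suc n) → ℚ) → ∑ (allFin (suc n)) h ≡ h Fin.zero + ∑[ i ∈ allFin n ] h (Fin.suc i)
  ∑-allFin-suc n h = cong (λ hs → h Fin.zero + sumℚ hs) (trans (map-tabulate Fin.suc h) (sym (map-tabulate id (h ∘ Fin.suc))))

  ∑-allFin-punchIn : ∀ n (v : Fin (suc n)) h → ∑ (allFin (suc n)) h ≡ h v + ∑[ i ∈ allFin n ] h (punchIn v i)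
  ∑-allFin-punchIn n       Fin.zero    h = ∑-allFin-suc n h
  ∑-allFin-punchIn (suc n) (Fin.suc v) h = begin
    ∑ (allFin (suc (suc n))) h
      ≡⟨ ∑-allFin-suc (suc n) h ⟩
    h Fin.zero + ∑[ i ∈ allFin (suc n) ] h (Fin.suc i)
      ≡⟨ cong (_+_ (h Fin.zero)) (∑-allFin-punchIn n v (h ∘ Fin.suc)) ⟩
    h Fin.zero + (h (Fin.suc v) + ∑[ i ∈ allFin n ] h (Fin.suc (punchIn v i)))
      ≡⟨ solve 3 (λ a b c → a :+ (b :+ c) := b :+ (a :+ c)) refl (h Fin.zero) (h (Fin.suc v)) _ ⟩
    h (Fin.suc v) + (h Fin.zero + ∑[ i ∈ allFin n ] h (Fin.suc (punchIn v i)))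
      ≡⟨ cong (_+_ (h (Fin.suc v))) (sym (∑-allFin-suc n (h ∘ punchIn (Fin.suc v)))) ⟩
    h (Fin.suc v) + ∑[ i ∈ allFin (suc n) ] h (punchIn (Fin.suc v) i) ∎
    where open ≡-Reasoning

  ∑-allFin-punchIn-vanishing : ∀ n (v : Fin (suc n)) h → h v ≡ 0ℚ →
                               ∑ (allFin (suc n)) h ≡ ∑[ i ∈ allFin n ] h (punchIn v i)
  ∑-allFin-punchIn-vanishing n v h hv≡0 =
    trans (∑-allFin-punchIn n v h) (trans (cong (_+ rest) hv≡0) (+-identityˡ rest))
    where rest = ∑[ i ∈ allFin n ] h (punchIn v i)

  punchIn₂ : ∀ {n} {a b : Fin (suc (suc n))} → a ≢ b → Fin n → Fin (suc (suc n))
  punchIn₂ {a = a} a≢b = punchIn a ∘ punchIn (punchOut a≢b)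

  ∑-allFin-vanishing₂ : ∀ n {a b : Fin (suc (suc n))} (a≢b : a ≢ b) h → h a ≡ 0ℚ → h b ≡ 0ℚ →
                        ∑ (allFin (suc (suc n))) h ≡ ∑[ i ∈ allFin n ] h (punchIn₂ a≢b i)
  ∑-allFin-vanishing₂ n {a} a≢b h ha≡0 hb≡0 =
    trans (∑-allFin-punchIn-vanishing (suc n) a h ha≡0)
          (∑-allFin-punchIn-vanishing n (punchOut a≢b) (h ∘ punchIn a) (trans (cong h (punchIn-punchOut a≢b)) hb≡0))

  -- (+ a) / suc d is fromℚᵘ (mkℚᵘ (+ a) d) by definition, so these two identities reduce to
  -- integer arithmetic on unnormalised rationals.
  1+n/1≡[1+n]/1 : ∀ n → 1ℚ + (+ n) / 1 ≡ (+ suc n) / 1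
  1+n/1≡[1+n]/1 n = toℚᵘ-injective (ℚᵘ.≃-trans (toℚᵘ-homo-+ 1ℚ ((+ n) / 1))
    (ℚᵘ.≃-trans (ℚᵘ.+-cong (ℚᵘ.≃-refl {toℚᵘ 1ℚ}) (toℚᵘ-fromℚᵘ (ℚᵘ.mkℚᵘ (+ n) 0)))
    (ℚᵘ.≃-trans (ℚᵘ.*≡* integers) (ℚᵘ.≃-sym (toℚᵘ-fromℚᵘ (ℚᵘ.mkℚᵘ (+ suc n) 0))))))
    where
      1+n = ℚᵘ.mkℚᵘ (+ 1) 0 ℚᵘ.+ ℚᵘ.mkℚᵘ (+ n) 0
      integers : ℚᵘ.↥ 1+n ℤ.* ℚᵘ.↧ (ℚᵘ.mkℚᵘ (+ suc n) 0)
               ≡ ℚᵘ.↥ (ℚᵘ.mkℚᵘ (+ suc n) 0) ℤ.* ℚᵘ.↧ 1+n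
      integers = trans (ℤ.*-identityʳ _) (trans (cong (ℤ._+_ (+ 1)) (ℤ.*-identityʳ (+ n))) (sym (ℤ.*-identityʳ _)))

  [a/1+n]*[1+n]≡a : ∀ a n → (+ a) / suc n * ((+ suc n) / 1) ≡ (+ a) / 1
  [a/1+n]*[1+n]≡a a n = toℚᵘ-injective (ℚᵘ.≃-trans (toℚᵘ-homo-* ((+ a) / suc n) ((+ suc n) / 1))
    (ℚᵘ.≃-trans (ℚᵘ.*-cong (toℚᵘ-fromℚᵘ (ℚᵘ.mkℚᵘ (+ a) n)) (toℚᵘ-fromℚᵘ (ℚᵘ.mkℚᵘ (+ suc n) 0)))
    (ℚᵘ.≃-trans (ℚᵘ.*≡* integers) (ℚᵘ.≃-sym (toℚᵘ-fromℚᵘ (ℚᵘ.mkℚᵘ (+ a) 0))))))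
    where
      a/[1+n]*[1+n] = ℚᵘ.mkℚᵘ (+ a) n ℚᵘ.* ℚᵘ.mkℚᵘ (+ suc n) 0
      integers : ℚᵘ.↥ a/[1+n]*[1+n] ℤ.* ℚᵘ.↧ (ℚᵘ.mkℚᵘ (+ a) 0)
               ≡ ℚᵘ.↥ (ℚᵘ.mkℚᵘ (+ a) 0) ℤ.* ℚᵘ.↧ a/[1+n]*[1+n]
      integers = trans (ℤ.*-identityʳ _) (cong (λ d → + a ℤ.* + d) (sym (ℕ.*-identityʳ (suc n))))

  ∑-allFin-const : ∀ n c → ∑[ i ∈ allFin n ] c ≡ (+ n) / 1 * c
  ∑-allFin-const zero    c = sym (*-zeroˡ c)
  ∑-allFin-const (suc n) c = begin
    ∑[ i ∈ allFin (suc n) ] c  ≡⟨ ∑-allFin-suc n (λ _ → c) ⟩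
    c + ∑[ i ∈ allFin n ] c    ≡⟨ cong (_+_ c) (∑-allFin-const n c) ⟩
    c + (+ n) / 1 * c          ≡⟨ solve 2 (λ c m → c :+ m :* c := (con 1ℚ :+ m) :* c) refl c ((+ n) / 1) ⟩
    (1ℚ + (+ n) / 1) * c       ≡⟨ cong (_* c) (1+n/1≡[1+n]/1 n) ⟩
    (+ suc n) / 1 * c          ∎
    where open ≡-Reasoning


open import Relation.Binary.Definitions using (DecidableEquality)

module FourierMotzkin {K : Set} (_≟_ : DecidableEquality K) where

  open import Data.Bool using (Bool; true; false; if_then_else_)
  open import Data.List using (List; []; _∷_; _++_; map; concatMap; foldr)
  open import Data.List.Membership.Propositional using (_∈_)
  open import Data.List.Relation.Unary.All as All using (All; []; _∷_; all?)
  import Data.List.Relation.Unary.All.Properties as All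
  open import Data.Product using (∃; _×_; _,_; proj₁; proj₂)
  open import Data.Rational using (ℚ; 0ℚ; 1ℚ; _+_; _*_; -_; 1/_; _<_; _≤_; _≤?_; positive; nonNegative)
  open import Data.Rational.Properties hiding (_≟_)
  open import Data.Rational.Solver using (module +-*-Solver)
  open import Function using (_⇔_; mk⇔; Equivalence)
  open import Relation.Binary.Bundles using (DecTotalOrder)
  open import Relation.Binary.Definitions using (tri<; tri≈; tri>)
  open import Relation.Binary.PropositionalEquality
  open import Relation.Nullary using (Dec; yes; no; does)
  open import Relation.Nullary.Decidable using (map′; dec-true)
  open import Data.List.Extrema (DecTotalOrder.totalOrder ≤-decTotalOrder) using (min; max; min≤xs; xs≤max; max≤v⁺)
  open Equivalence using (to; from)
  open +-*-Solver
  open Sums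

  between : ∀ {A B : Set} (xs : List A) (ys : List B) (lo : A → ℚ) (hi : B → ℚ) →
            (∀ {x y} → x ∈ xs → y ∈ ys → lo x ≤ hi y) →
            ∃ λ v → All (λ x → lo x ≤ v) xs × All (λ y → v ≤ hi y) ys
  between xs ys lo hi lo≤hi =
    v , All.map⁻ (xs≤max start (map lo xs)) , All.tabulate below
    where
      start = min 0ℚ (map hi ys)
      v = max start (map lo xs)
      below : ∀ {y} → y ∈ ys → v ≤ hi y
      below y∈ys = max≤v⁺ (All.lookup (All.map⁻ (min≤xs 0ℚ (map hi ys))) y∈ys)
                          (All.map⁺ (All.tabulate (λ x∈xs → lo≤hi x∈xs y∈ys)))

  reciprocal : (a : ℚ) → 0ℚ < a → ℚ
  reciprocal a a>0 = 1/_ a {{pos⇒nonZero a {{positive a>0}}}}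

  reciprocal-pos : ∀ a (a>0 : 0ℚ < a) → 0ℚ < reciprocal a a>0
  reciprocal-pos a a>0 = positive⁻¹ _ {{1/pos⇒pos a {{positive a>0}}}}

  reciprocal-inverse : ∀ a (a>0 : 0ℚ < a) → reciprocal a a>0 * a ≡ 1ℚ
  reciprocal-inverse a a>0 = *-inverseˡ a {{pos⇒nonZero a {{positive a>0}}}}

  *-monoˡ-≤-⇔ : ∀ {c p q} → 0ℚ < c → p ≤ q ⇔ c * p ≤ c * q
  *-monoˡ-≤-⇔ {c} c>0 = mk⇔ (*-monoˡ-≤-nonNeg c {{nonNegative (<⇒≤ c>0)}}) (*-cancelˡ-≤-pos c {{positive c>0}})

  0≤-rescale : ∀ {c p q} → 0ℚ < c → c * p ≡ q → 0ℚ ≤ p ⇔ 0ℚ ≤ q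
  0≤-rescale {c} {p} c>0 refl = subst (λ z → 0ℚ ≤ p ⇔ z ≤ c * p) (*-zeroʳ c) (*-monoˡ-≤-⇔ c>0)

  0≤p-q⇔q≤p : ∀ {p q} → 0ℚ ≤ p + - q ⇔ q ≤ p
  0≤p-q⇔q≤p {p} {q} = mk⇔
    (λ 0≤p-q → subst₂ _≤_ (+-identityˡ q) (solve 2 (λ p q → (p :+ :- q) :+ q := p) refl p q) (+-monoˡ-≤ q 0≤p-q))
    (λ q≤p → subst (_≤ p + - q) (+-inverseʳ q) (+-monoˡ-≤ (- q) q≤p))

  record Form : Set where
    constructor form
    field
      coeff : K → ℚ
      const : ℚ
  open Form public

  eval : List K → Form → (K → ℚ) → ℚ
  eval L φ x = ∑[ k ∈ L ] (coeff φ k * x k) + const φ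

  Satisfies : List K → List Form → (K → ℚ) → Set
  Satisfies L φs x = All (λ φ → 0ℚ ≤ eval L φ x) φs

  _⊛_ : ℚ → Form → Form
  c ⊛ φ = form (λ k → c * coeff φ k) (c * const φ)

  _⊕_ : Form → Form → Form
  φ ⊕ ψ = form (λ k → coeff φ k + coeff ψ k) (const φ + const ψ)

  eval-⊛ : ∀ L c φ x → eval L (c ⊛ φ) x ≡ c * eval L φ x
  eval-⊛ L c φ x = trans
    (cong (_+ c * const φ) (trans (∑-cong L (λ k → *-assoc c (coeff φ k) (x k))) (∑-*ˡ L c _)))
    (sym (*-distribˡ-+ c _ (const φ)))

  eval-⊕ : ∀ L φ ψ x → eval L (φ ⊕ ψ) x ≡ eval L φ x + eval L ψ x
  eval-⊕ L φ ψ x = trans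
    (cong (_+ (const φ + const ψ))
      (trans (∑-cong L (λ k → *-distribʳ-+ (x k) (coeff φ k) (coeff ψ k))) (∑-+ L _ _)))
    (solve 4 (λ a b c d → (a :+ b) :+ (c :+ d) := (a :+ c) :+ (b :+ d)) refl
      (∑[ k ∈ L ] (coeff φ k * x k)) (∑[ k ∈ L ] (coeff ψ k * x k)) (const φ) (const ψ))

  module Elimination (k₀ : K) (L : List K) where

    isPivot : K → Bool
    isPivot k = does (k ≟ k₀)

    pivotCoeff : Form → K → ℚ
    pivotCoeff φ k = if isPivot k then coeff φ k else 0ℚ

    -- L may list k₀ again, so the coefficient of x k₀ collects all of its occurrences.
    pivot : Form → ℚ
    pivot φ = ∑ (k₀ ∷ L) (pivotCoeff φ)

    dropPivot : Form → Form
    dropPivot φ = form (λ k → if isPivot k then 0ℚ else coeff φ k) (const φ)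

    set : (K → ℚ) → ℚ → K → ℚ
    set y v k = if isPivot k then v else y k

    set-pivot : ∀ y v → set y v k₀ ≡ v
    set-pivot y v rewrite dec-true (k₀ ≟ k₀) refl = refl

    eval-pivot : ∀ φ x → eval (k₀ ∷ L) φ x ≡ pivot φ * x k₀ + eval L (dropPivot φ) x
    eval-pivot φ x = begin
      ∑[ k ∈ k₀ ∷ L ] (coeff φ k * x k) + const φ
        ≡⟨ cong (_+ const φ) (trans (∑-cong (k₀ ∷ L) split) (∑-+ (k₀ ∷ L) onPivot rest)) ⟩
      ∑ (k₀ ∷ L) onPivot + ∑ (k₀ ∷ L) rest + const φ
        ≡⟨ cong₂ (λ a b → a + b + const φ) (∑-*ʳ (k₀ ∷ L) (pivotCoeff φ) (x k₀)) head-vanishes ⟩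
      pivot φ * x k₀ + (0ℚ + ∑ L rest) + const φ
        ≡⟨ solve 3 (λ a b c → a :+ (con 0ℚ :+ b) :+ c := a :+ (b :+ c)) refl (pivot φ * x k₀) (∑ L rest) (const φ) ⟩
      pivot φ * x k₀ + eval L ψ x ∎
      where
        open ≡-Reasoning
        ψ = dropPivot φ
        onPivot rest : K → ℚ
        onPivot k = pivotCoeff φ k * x k₀
        rest k = coeff ψ k * x k
        split : ∀ k → coeff φ k * x k ≡ onPivot k + rest k
        split k with k ≟ k₀
        ... | yes refl = solve 2 (λ c y → c :* y := c :* y :+ con 0ℚ :* y) refl (coeff φ k) (x k)
        ... | no _     = solve 3 (λ c y z → c :* z := con 0ℚ :* y :+ c :* z) refl (coeff φ k) (x k₀) (x k)
        head-vanishes : rest k₀ + ∑ L rest ≡ 0ℚ + ∑ L rest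
        head-vanishes rewrite dec-true (k₀ ≟ k₀) refl = cong (_+ ∑ L rest) (*-zeroˡ (x k₀))

    eval-dropPivot-set : ∀ φ y v → eval L (dropPivot φ) (set y v) ≡ eval L (dropPivot φ) y
    eval-dropPivot-set φ y v = cong (_+ const φ) (∑-cong L unaffected)
      where
        unaffected : ∀ k → coeff (dropPivot φ) k * set y v k ≡ coeff (dropPivot φ) k * y k
        unaffected k with isPivot k
        ... | true  = trans (*-zeroˡ v) (sym (*-zeroˡ (y k)))
        ... | false = refl

    Holds : ℚ → (K → ℚ) → Form → Set
    Holds v y φ = 0ℚ ≤ pivot φ * v + eval L (dropPivot φ) y

    satisfies⇒holds : ∀ {φs x} → Satisfies (k₀ ∷ L) φs x → All (Holds (x k₀) x) φs
    satisfies⇒holds {x = x} = All.map (λ {φ} → subst (0ℚ ≤_) (eval-pivot φ x))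

    holds⇒satisfies : ∀ {φs v y} → All (Holds v y) φs → Satisfies (k₀ ∷ L) φs (set y v)
    holds⇒satisfies {v = v} {y} = All.map λ {φ} → subst (0ℚ ≤_) (sym (begin
      eval (k₀ ∷ L) φ (set y v)
        ≡⟨ eval-pivot φ (set y v) ⟩
      pivot φ * set y v k₀ + eval L (dropPivot φ) (set y v)
        ≡⟨ cong₂ (λ a b → pivot φ * a + b) (set-pivot y v) (eval-dropPivot-set φ y v) ⟩
      pivot φ * v + eval L (dropPivot φ) y ∎))
      where open ≡-Reasoning

    record Split : Set where
      constructor split
      field
        zeros lowers uppers : List Form

    insert : Form → Split → Split
    insert φ (split Z P N) with <-cmp (pivot φ) 0ℚ
    ... | tri< a<0 _ _ = split Z P (reciprocal (- pivot φ) (neg-antimono-< a<0) ⊛ dropPivot φ ∷ N)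
    ... | tri≈ _ a≡0 _ = split (dropPivot φ ∷ Z) P N
    ... | tri> _ _ a>0 = split Z (reciprocal (pivot φ) a>0 ⊛ dropPivot φ ∷ P) N

    sortByPivot : List Form → Split
    sortByPivot = foldr insert (split [] [] [])

    SplitHolds : ℚ → (K → ℚ) → Split → Set
    SplitHolds v y (split Z P N) =
      Satisfies L Z y × All (λ ψ → 0ℚ ≤ v + eval L ψ y) P × All (λ ψ → 0ℚ ≤ - v + eval L ψ y) N

    holds⇔⁰ : ∀ {v y φ} → pivot φ ≡ 0ℚ → Holds v y φ ⇔ 0ℚ ≤ eval L (dropPivot φ) y
    holds⇔⁰ {v} {y} {φ} a≡0 = mk⇔ (subst (0ℚ ≤_) eq) (subst (0ℚ ≤_) (sym eq))
      where
        e = eval L (dropPivot φ) y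
        eq : pivot φ * v + e ≡ e
        eq = trans (cong (λ a → a * v + e) a≡0) (trans (cong (_+ e) (*-zeroˡ v)) (+-identityˡ e))

    holds⇔⁺ : ∀ {v y φ} (a>0 : 0ℚ < pivot φ) →
              Holds v y φ ⇔ 0ℚ ≤ v + eval L (reciprocal (pivot φ) a>0 ⊛ dropPivot φ) y
    holds⇔⁺ {v} {y} {φ} a>0 = 0≤-rescale (reciprocal-pos a a>0) (begin
      c * (a * v + e)      ≡⟨ solve 4 (λ c a v e → c :* (a :* v :+ e) := (c :* a) :* v :+ c :* e) refl c a v e ⟩
      (c * a) * v + c * e  ≡⟨ cong (λ u → u * v + c * e) (reciprocal-inverse a a>0) ⟩
      1ℚ * v + c * e       ≡⟨ cong₂ _+_ (*-identityˡ v) (sym (eval-⊛ L c (dropPivot φ) y)) ⟩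
      v + eval L (c ⊛ dropPivot φ) y ∎)
      where
        open ≡-Reasoning
        a = pivot φ
        c = reciprocal a a>0
        e = eval L (dropPivot φ) y

    holds⇔⁻ : ∀ {v y φ} (a<0 : pivot φ < 0ℚ) →
              Holds v y φ ⇔ 0ℚ ≤ - v + eval L (reciprocal (- pivot φ) (neg-antimono-< a<0) ⊛ dropPivot φ) y
    holds⇔⁻ {v} {y} {φ} a<0 = 0≤-rescale (reciprocal-pos (- a) -a>0) (begin
      c * (a * v + e)            ≡⟨ solve 4 (λ c a v e → c :* (a :* v :+ e) := :- ((c :* (:- a)) :* v) :+ c :* e) refl c a v e ⟩
      - ((c * - a) * v) + c * e  ≡⟨ cong (λ u → - (u * v) + c * e) (reciprocal-inverse (- a) -a>0) ⟩
      - (1ℚ * v) + c * e         ≡⟨ cong₂ _+_ (cong -_ (*-identityˡ v)) (sym (eval-⊛ L c (dropPivot φ) y)) ⟩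
      - v + eval L (c ⊛ dropPivot φ) y ∎)
      where
        open ≡-Reasoning
        a = pivot φ
        -a>0 = neg-antimono-< a<0
        c = reciprocal (- a) -a>0
        e = eval L (dropPivot φ) y

    insert-holds : ∀ φ S {v y} → (Holds v y φ × SplitHolds v y S) ⇔ SplitHolds v y (insert φ S)
    insert-holds φ (split Z P N) with <-cmp (pivot φ) 0ℚ
    ... | tri< a<0 _ _ = mk⇔ (λ (h , z , p , n) → z , p , to (holds⇔⁻ a<0) h ∷ n)
                             (λ { (z , p , h ∷ n) → from (holds⇔⁻ a<0) h , z , p , n })
    ... | tri≈ _ a≡0 _ = mk⇔ (λ (h , z , p , n) → to (holds⇔⁰ a≡0) h ∷ z , p , n)
                             (λ { (h ∷ z , p , n) → from (holds⇔⁰ a≡0) h , z , p , n })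
    ... | tri> _ _ a>0 = mk⇔ (λ (h , z , p , n) → z , to (holds⇔⁺ a>0) h ∷ p , n)
                             (λ { (z , h ∷ p , n) → from (holds⇔⁺ a>0) h , z , p , n })

    sortByPivot-holds : ∀ φs {v y} → All (Holds v y) φs ⇔ SplitHolds v y (sortByPivot φs)
    sortByPivot-holds []       = mk⇔ (λ _ → [] , [] , []) (λ _ → [])
    sortByPivot-holds (φ ∷ φs) = mk⇔
      (λ { (h ∷ hs) → to (insert-holds φ (sortByPivot φs)) (h , to (sortByPivot-holds φs) hs) })
      (λ hs → let (h , hs′) = from (insert-holds φ (sortByPivot φs)) hs
              in h ∷ from (sortByPivot-holds φs) hs′)

    -- x k₀ can be chosen iff each lower bound −ψ (ψ ∈ lowers) is at most each upper bound χ (χ ∈ uppers).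
    eliminate : Split → List Form
    eliminate (split Z P N) = Z ++ concatMap (λ p → map (p ⊕_) N) P

    eliminate-complete : ∀ S {v y} → SplitHolds v y S → Satisfies L (eliminate S) y
    eliminate-complete (split Z P N) {v} {y} (z , p , n) =
      All.++⁺ z (All.concat⁺ (All.map⁺ (All.map (λ {ψ} 0≤v+ψ → All.map⁺ (All.map (λ {χ} → sum ψ χ 0≤v+ψ) n)) p)))
      where
        sum : ∀ ψ χ → 0ℚ ≤ v + eval L ψ y → 0ℚ ≤ - v + eval L χ y → 0ℚ ≤ eval L (ψ ⊕ χ) y
        sum ψ χ 0≤v+ψ 0≤-v+χ = subst₂ _≤_ (+-identityˡ 0ℚ)
          (trans (solve 3 (λ v a b → (v :+ a) :+ (:- v :+ b) := a :+ b) refl v (eval L ψ y) (eval L χ y))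
                 (sym (eval-⊕ L ψ χ y)))
          (+-mono-≤ 0≤v+ψ 0≤-v+χ)

    eliminate-sound : ∀ S {y} → Satisfies L (eliminate S) y → ∃ λ v → SplitHolds v y S
    eliminate-sound (split Z P N) {y} sat =
      v , All.++⁻ˡ Z sat
        , All.map (λ {ψ} → above {ψ}) (proj₁ (proj₂ bounds))
        , All.map (λ {χ} → below {χ}) (proj₂ (proj₂ bounds))
      where
        lo hi : Form → ℚ
        lo ψ = - eval L ψ y
        hi χ = eval L χ y
        pairs : All (λ ψ → Satisfies L (map (ψ ⊕_) N) y) P
        pairs = All.map⁻ (All.concat⁻ (All.++⁻ʳ Z sat))
        lo≤hi : ∀ {ψ χ} → ψ ∈ P → χ ∈ N → lo ψ ≤ hi χ
        lo≤hi {ψ} {χ} ψ∈P χ∈N = subst₂ _≤_ (+-identityˡ (lo ψ))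
          (solve 2 (λ a b → (a :+ b) :+ :- a := b) refl (eval L ψ y) (hi χ))
          (+-monoˡ-≤ (lo ψ) (subst (0ℚ ≤_) (eval-⊕ L ψ χ y) (All.lookup (All.map⁻ (All.lookup pairs ψ∈P)) χ∈N)))
        bounds : ∃ λ v → All (λ ψ → lo ψ ≤ v) P × All (λ χ → v ≤ hi χ) N
        bounds = between P N lo hi lo≤hi
        v = proj₁ bounds
        above : ∀ {ψ} → lo ψ ≤ v → 0ℚ ≤ v + eval L ψ y
        above {ψ} lo≤v = subst₂ _≤_ (+-inverseˡ (eval L ψ y)) refl (+-monoˡ-≤ (eval L ψ y) lo≤v)
        below : ∀ {χ} → v ≤ hi χ → 0ℚ ≤ - v + eval L χ y
        below v≤hi = subst₂ _≤_ (+-inverseˡ v) refl (+-monoʳ-≤ (- v) v≤hi)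

  feasible? : ∀ L φs → Dec (∃ (Satisfies L φs))
  feasible? []      φs = map′ (λ sat → (λ _ → 0ℚ) , sat) proj₂ (all? (λ φ → 0ℚ ≤? eval [] φ (λ _ → 0ℚ)) φs)
  feasible? (k₀ ∷ L) φs = map′ lift project (feasible? L (eliminate (sortByPivot φs)))
    where
      open Elimination k₀ L
      lift : ∃ (Satisfies L (eliminate (sortByPivot φs))) → ∃ (Satisfies (k₀ ∷ L) φs)
      lift (y , sat) =
        let (v , holds) = eliminate-sound (sortByPivot φs) sat
        in set y v , holds⇒satisfies (from (sortByPivot-holds φs {v} {y}) holds)
      project : ∃ (Satisfies (k₀ ∷ L) φs) → ∃ (Satisfies L (eliminate (sortByPivot φs)))
      project (x , sat) =
        x , eliminate-complete (sortByPivot φs) {x k₀} (to (sortByPivot-holds φs) (satisfies⇒holds sat))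

module Triples where

  open import Defs
  open import Data.Bool using (Bool; true; false; if_then_else_)
  import Data.Bool as Bool
  open import Data.Fin using (Fin; punchIn; _<_)
  open import Data.Fin.Properties using (_<?_; punchIn-mono-≤; punchIn-cancel-≤; punchIn-injective; ≤∧≢⇒<; <⇒≢)
  open import Data.List using (List; map; filter; allFin; concatMap)
  open import Data.List.Membership.Propositional using (_∈_; lose)
  open import Data.List.Membership.Propositional.Properties using (∈-filter⁺; ∈-filter⁻; ∈-concatMap⁺; ∈-map⁺; ∈-allFin)
  open import Data.Nat using (ℕ; suc)
  import Data.Nat.Properties as ℕ
  open import Data.Product using (_×_; _,_; proj₂)
  open import Data.Product.Function.NonDependent.Propositional using (_×-⇔_)
  open import Data.Rational using (ℚ; 0ℚ)
  open import Function using (_∘_; _⇔_; mk⇔)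
  open import Relation.Binary.PropositionalEquality
  open import Relation.Nullary using (does)
  open import Relation.Nullary.Decidable using (_×-dec_; does-⇔)
  open Sums

  private
    variable
      n : ℕ

  -- triples n unfolds to a filter of this list; naming it lets Agda instantiate the filter lemmas.
  allTriples : ∀ n → List (Triple n)
  allTriples n = concatMap (λ i → concatMap (λ j → map (λ k → i , j , k) (allFin n)) (allFin n)) (allFin n)

  ∈-triples⁺ : ∀ {i j k : Fin n} → i < j → j < k → (i , j , k) ∈ triples n
  ∈-triples⁺ {n} {i} {j} {k} i<j j<k = ∈-filter⁺ _ {xs = allTriples n}
    (∈-concatMap⁺ _ (lose (∈-allFin i) (∈-concatMap⁺ _ (lose (∈-allFin j) (∈-map⁺ _ (∈-allFin k))))))
    (i<j , j<k)

  ∈-triples⁻ : ∀ {i j k : Fin n} → (i , j , k) ∈ triples n → i < j × j < k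
  ∈-triples⁻ {n} T∈ = proj₂ (∈-filter⁻ _ {xs = allTriples n} T∈)

  ordered : Fin n → Fin n → Fin n → Bool
  ordered i j k = does ((i <? j) ×-dec (j <? k))

  ∑-triples : ∀ n (g : Triple n → ℚ) → ∑ (triples n) g ≡
              ∑[ i ∈ allFin n ] ∑[ j ∈ allFin n ] ∑[ k ∈ allFin n ] (if ordered i j k then g (i , j , k) else 0ℚ)
  ∑-triples n g =
    trans (∑-filter _ (allTriples n) g)
    (trans (∑-concatMap _ (allFin n) _)
      (∑-cong (allFin n) λ i → trans (∑-concatMap _ (allFin n) _)
        (∑-cong (allFin n) λ j → ∑-map (λ k → i , j , k) (allFin n) _)))

  punchIn-<⇔ : ∀ (v : Fin (suc n)) {i j} → i < j ⇔ punchIn v i < punchIn v j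
  punchIn-<⇔ v {i} {j} = mk⇔
    (λ i<j → ≤∧≢⇒< (punchIn-mono-≤ v i j (ℕ.<⇒≤ i<j)) (<⇒≢ i<j ∘ punchIn-injective v i j))
    (λ i<j → ≤∧≢⇒< (punchIn-cancel-≤ v i j (ℕ.<⇒≤ i<j)) (<⇒≢ i<j ∘ cong (punchIn v)))

  ordered-punchIn : ∀ (v : Fin (suc n)) i j k → ordered (punchIn v i) (punchIn v j) (punchIn v k) ≡ ordered i j k
  ordered-punchIn v i j k =
    sym (does-⇔ (punchIn-<⇔ v {i} {j} ×-⇔ punchIn-<⇔ v {j} {k})
      ((i <? j) ×-dec (j <? k)) ((punchIn v i <? punchIn v j) ×-dec (punchIn v j <? punchIn v k)))

  punchInTriple : Fin (suc n) → Triple n → Triple (suc n)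
  punchInTriple v (i , j , k) = punchIn v i , punchIn v j , punchIn v k

  ∑-triples-punchIn : ∀ n (v : Fin (suc n)) (g : Triple (suc n) → ℚ) →
                      (∀ j k → g (v , j , k) ≡ 0ℚ) → (∀ i k → g (i , v , k) ≡ 0ℚ) →
                      (∀ i j → g (i , j , v) ≡ 0ℚ) →
                      ∑ (triples (suc n)) g ≡ ∑ (triples n) (g ∘ punchInTriple v)
  ∑-triples-punchIn n v g g₁≡0 g₂≡0 g₃≡0 = begin
    ∑ (triples (suc n)) g
      ≡⟨ ∑-triples (suc n) g ⟩
    ∑[ i ∈ allFin (suc n) ] ∑[ j ∈ allFin (suc n) ] ∑[ k ∈ allFin (suc n) ] G i j k
      ≡⟨ ∑-allFin-punchIn-vanishing n v (λ i → ∑[ j ∈ allFin (suc n) ] ∑ (allFin (suc n)) (G i j))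
           (∑-vanishing λ j → ∑-vanishing λ k → if-vanishing (ordered v j k) (g₁≡0 j k)) ⟩
    ∑[ i ∈ allFin n ] ∑[ j ∈ allFin (suc n) ] ∑[ k ∈ allFin (suc n) ] G (pI i) j k
      ≡⟨ ∑-cong (allFin n) (λ i → ∑-allFin-punchIn-vanishing n v (λ j → ∑ (allFin (suc n)) (G (pI i) j))
           (∑-vanishing λ k → if-vanishing (ordered (pI i) v k) (g₂≡0 (pI i) k))) ⟩
    ∑[ i ∈ allFin n ] ∑[ j ∈ allFin n ] ∑[ k ∈ allFin (suc n) ] G (pI i) (pI j) k
      ≡⟨ ∑-cong (allFin n) (λ i → ∑-cong (allFin n) λ j → ∑-allFin-punchIn-vanishing n v (G (pI i) (pI j))
           (if-vanishing (ordered (pI i) (pI j) v) (g₃≡0 (pI i) (pI j)))) ⟩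
    ∑[ i ∈ allFin n ] ∑[ j ∈ allFin n ] ∑[ k ∈ allFin n ] G (pI i) (pI j) (pI k)
      ≡⟨ ∑-cong (allFin n) (λ i → ∑-cong (allFin n) λ j → ∑-cong (allFin n) λ k →
           cong (if_then g (pI i , pI j , pI k) else 0ℚ) (ordered-punchIn v i j k)) ⟩
    ∑[ i ∈ allFin n ] ∑[ j ∈ allFin n ] ∑[ k ∈ allFin n ] (if ordered i j k then g (pI i , pI j , pI k) else 0ℚ)
      ≡⟨ sym (∑-triples n (g ∘ punchInTriple v)) ⟩
    ∑ (triples n) (g ∘ punchInTriple v) ∎
    where
      open ≡-Reasoning
      pI = punchIn v
      G : Fin (suc n) → Fin (suc n) → Fin (suc n) → ℚ
      G i j k = if ordered i j k then g (i , j , k) else 0ℚ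
      ∑-vanishing : ∀ {h : Fin (suc n) → ℚ} → (∀ i → h i ≡ 0ℚ) → ∑ (allFin (suc n)) h ≡ 0ℚ
      ∑-vanishing h≡0 = trans (∑-cong (allFin (suc n)) h≡0) (∑-zero (allFin (suc n)))

  -- Written exactly like the sums in Defs, so transValue and the pair sums of IsFracTriDecomp are
  -- instances of weightOf by definition.
  weightOf : (Triple n → Bool) → Weight n → ℚ
  weightOf {n} Q f = sumℚ (map f (filter (λ x → Q x Bool.≟ true) (triples n)))

  weightOf-∑ : ∀ (Q : Triple n → Bool) f → weightOf Q f ≡ ∑[ T ∈ triples n ] (if Q T then f T else 0ℚ)
  weightOf-∑ {n} Q f = trans (∑-filter (λ x → Q x Bool.≟ true) (triples n) f) (∑-cong (triples n) selected)
    where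
      selected : ∀ T → (if does (Q T Bool.≟ true) then f T else 0ℚ) ≡ (if Q T then f T else 0ℚ)
      selected T with Q T
      ... | true  = refl
      ... | false = refl

  weightOf-cong : ∀ {Q Q′ : Triple n → Bool} → (∀ T → Q T ≡ Q′ T) → ∀ f → weightOf Q f ≡ weightOf Q′ f
  weightOf-cong {n} {Q} {Q′} Q≗Q′ f = begin
    weightOf Q f                                   ≡⟨ weightOf-∑ Q f ⟩
    ∑[ T ∈ triples n ] (if Q T then f T else 0ℚ)   ≡⟨ ∑-cong (triples n) (λ T → cong (if_then f T else 0ℚ) (Q≗Q′ T)) ⟩
    ∑[ T ∈ triples n ] (if Q′ T then f T else 0ℚ)  ≡⟨ weightOf-∑ Q′ f ⟨
    weightOf Q′ f                                  ∎
    where open ≡-Reasoning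

  weightOf-false : ∀ {Q : Triple n → Bool} → (∀ T → Q T ≡ false) → ∀ f → weightOf Q f ≡ 0ℚ
  weightOf-false {n} Q≗false f = trans (weightOf-cong Q≗false f) (trans (weightOf-∑ (λ _ → false) f) (∑-zero (triples n)))

module VertexDeletion where

  open import Defs
  open import Data.Bool using (Bool; true; false; if_then_else_)
  open import Data.Bool.Properties using (∧-zeroʳ)
  open import Data.Fin as Fin using (Fin; punchIn; punchOut; _≟_)
  open import Data.Fin.Properties
    using ( punchIn-injective; punchInᵢ≢i; punchOut-cong; punchOut-punchIn; punchIn-punchOut
          ; punchOut-mono-≤; punchOut-injective; ≤∧≢⇒<; <⇒≢)
  open import Data.Integer using (+_)
  open import Data.List using (allFin)
  open import Data.List.Membership.Propositional using (_∈_)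
  open import Data.Nat as ℕ using (ℕ; suc)
  import Data.Nat.Properties as ℕ
  open import Data.Product using (_×_; _,_; proj₁; proj₂)
  open import Data.Rational using (ℚ; 0ℚ; 1ℚ; _*_; _/_; _≤_; NonNegative)
  open import Data.Rational.Properties
    using (≤-refl; nonNegative⁻¹; normalize-nonNeg; *-zeroʳ; *-identityʳ; *-monoˡ-≤-nonNeg; module ≤-Reasoning)
  open import Data.Rational.Solver using (module +-*-Solver)
  open import Function using (_∘_; mk⇔; Equivalence)
  open import Relation.Binary.PropositionalEquality
  open import Relation.Nullary using (yes; no; contradiction)
  open import Relation.Nullary.Decidable using (dec-false; does-⇔; isYes≗does)
  open +-*-Solver
  open Sums
  open Triples

  private
    variable
      n : ℕ

  deleteVertex : Tournament (suc n) → Fin (suc n) → Tournament n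
  deleteVertex G v = record
    { arc    = λ i j → arc G (punchIn v i) (punchIn v j)
    ; irrefl = λ i → irrefl G (punchIn v i)
    ; tourn  = λ i j i≢j → tourn G _ _ (i≢j ∘ punchIn-injective v i j)
    }

  deleteVertex-isExtension : ∀ (G : Tournament (suc n)) v → IsExtensionOf G (deleteVertex G v)
  deleteVertex-isExtension G v = punchIn v , punchIn-injective v _ _ , λ i j → refl

  extendByZero : Fin (suc n) → Weight n → Weight (suc n)
  extendByZero v f (i , j , k) with v ≟ i | v ≟ j | v ≟ k
  ... | no v≢i | no v≢j | no v≢k = f (punchOut v≢i , punchOut v≢j , punchOut v≢k)
  ... | _      | _      | _      = 0ℚ

  punchOut-punchIn′ : ∀ (v : Fin (suc n)) {i} (v≢i : v ≢ punchIn v i) → punchOut v≢i ≡ i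
  punchOut-punchIn′ v v≢i = trans (punchOut-cong v refl) (punchOut-punchIn v)

  extendByZero-punchIn : ∀ (v : Fin (suc n)) f T → extendByZero v f (punchInTriple v T) ≡ f T
  extendByZero-punchIn v f (i , j , k) with v ≟ punchIn v i | v ≟ punchIn v j | v ≟ punchIn v k
  ... | no v≢i | no v≢j | no v≢k =
    cong f (cong₂ _,_ (punchOut-punchIn′ v v≢i) (cong₂ _,_ (punchOut-punchIn′ v v≢j) (punchOut-punchIn′ v v≢k)))
  ... | yes v≡i | _ | _ = contradiction (sym v≡i) (punchInᵢ≢i v i)
  ... | no _ | yes v≡j | _ = contradiction (sym v≡j) (punchInᵢ≢i v j)
  ... | no _ | no _ | yes v≡k = contradiction (sym v≡k) (punchInᵢ≢i v k)

  extendByZero-vanishes₁ : ∀ (v : Fin (suc n)) f j k → extendByZero v f (v , j , k) ≡ 0ℚ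
  extendByZero-vanishes₁ v f j k with v ≟ v
  ... | yes _   = refl
  ... | no v≢v = contradiction refl v≢v

  extendByZero-vanishes₂ : ∀ (v : Fin (suc n)) f i k → extendByZero v f (i , v , k) ≡ 0ℚ
  extendByZero-vanishes₂ v f i k with v ≟ i | v ≟ v
  ... | yes _ | _      = refl
  ... | no _  | yes _  = refl
  ... | no _  | no v≢v = contradiction refl v≢v

  extendByZero-vanishes₃ : ∀ (v : Fin (suc n)) f i j → extendByZero v f (i , j , v) ≡ 0ℚ
  extendByZero-vanishes₃ v f i j with v ≟ i | v ≟ j | v ≟ v
  ... | yes _ | _     | _      = refl
  ... | no _  | yes _ | _      = refl
  ... | no _  | no _  | yes _  = refl
  ... | no _  | no _  | no v≢v = contradiction refl v≢v

  weightOf-extendByZero : ∀ (Q : Triple (suc n) → Bool) (v : Fin (suc n)) f →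
                          weightOf Q (extendByZero v f) ≡ weightOf (Q ∘ punchInTriple v) f
  weightOf-extendByZero {n} Q v f = begin
    weightOf Q (extendByZero v f)
      ≡⟨ weightOf-∑ Q (extendByZero v f) ⟩
    ∑[ T ∈ triples (suc n) ] (if Q T then extendByZero v f T else 0ℚ)
      ≡⟨ ∑-triples-punchIn n v (λ T → if Q T then extendByZero v f T else 0ℚ)
           (λ j k → if-vanishing (Q (v , j , k)) (extendByZero-vanishes₁ v f j k))
           (λ i k → if-vanishing (Q (i , v , k)) (extendByZero-vanishes₂ v f i k))
           (λ i j → if-vanishing (Q (i , j , v)) (extendByZero-vanishes₃ v f i j)) ⟩
    ∑[ T ∈ triples n ] (if Q (punchInTriple v T) then extendByZero v f (punchInTriple v T) else 0ℚ)
      ≡⟨ ∑-cong (triples n) (λ T → cong (if Q (punchInTriple v T) then_else 0ℚ) (extendByZero-punchIn v f T)) ⟩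
    ∑[ T ∈ triples n ] (if Q (punchInTriple v T) then f T else 0ℚ)
      ≡⟨ weightOf-∑ (Q ∘ punchInTriple v) f ⟨
    weightOf (Q ∘ punchInTriple v) f ∎
    where open ≡-Reasoning

  Bounded : Weight n → Set
  Bounded {n} f = ∀ T → T ∈ triples n → 0ℚ ≤ f T × f T ≤ 1ℚ

  punchOut-mono-< : ∀ {v i j : Fin (suc n)} (v≢i : v ≢ i) (v≢j : v ≢ j) → i Fin.< j → punchOut v≢i Fin.< punchOut v≢j
  punchOut-mono-< v≢i v≢j i<j =
    ≤∧≢⇒< (punchOut-mono-≤ v≢i v≢j (ℕ.<⇒≤ i<j)) (<⇒≢ i<j ∘ punchOut-injective v≢i v≢j)

  extendByZero-bounded : ∀ (v : Fin (suc n)) {f} → Bounded f → Bounded (extendByZero v f)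
  extendByZero-bounded v bounded (i , j , k) T∈ with v ≟ i | v ≟ j | v ≟ k | ∈-triples⁻ T∈
  ... | no v≢i | no v≢j | no v≢k | i<j , j<k =
    bounded _ (∈-triples⁺ (punchOut-mono-< v≢i v≢j i<j) (punchOut-mono-< v≢j v≢k j<k))
  ... | yes _ | _     | _     | _ = ≤-refl , nonNegative⁻¹ 1ℚ
  ... | no _  | yes _ | _     | _ = ≤-refl , nonNegative⁻¹ 1ℚ
  ... | no _  | no _  | yes _ | _ = ≤-refl , nonNegative⁻¹ 1ℚ

  ==ᵇ-punchIn : ∀ (v : Fin (suc n)) a i → (punchIn v a ==ᵇ punchIn v i) ≡ (a ==ᵇ i)
  ==ᵇ-punchIn v a i = trans (isYes≗does (punchIn v a ≟ punchIn v i))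
    (trans (does-⇔ (mk⇔ (punchIn-injective v a i) (cong (punchIn v))) (punchIn v a ≟ punchIn v i) (a ≟ i))
           (sym (isYes≗does (a ≟ i))))

  ==ᵇ-punchIn-self : ∀ (v : Fin (suc n)) i → (v ==ᵇ punchIn v i) ≡ false
  ==ᵇ-punchIn-self v i = trans (isYes≗does (v ≟ punchIn v i)) (dec-false (v ≟ punchIn v i) (punchInᵢ≢i v i ∘ sym))

  contains-punchIn : ∀ (v : Fin (suc n)) a b T → contains (punchIn v a) (punchIn v b) (punchInTriple v T) ≡ contains a b T
  contains-punchIn v a b (i , j , k)
    rewrite ==ᵇ-punchIn v a i | ==ᵇ-punchIn v a j | ==ᵇ-punchIn v a k
          | ==ᵇ-punchIn v b i | ==ᵇ-punchIn v b j | ==ᵇ-punchIn v b k = refl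

  contains-punchIn-self₁ : ∀ (v : Fin (suc n)) b T → contains v b (punchInTriple v T) ≡ false
  contains-punchIn-self₁ v b (i , j , k)
    rewrite ==ᵇ-punchIn-self v i | ==ᵇ-punchIn-self v j | ==ᵇ-punchIn-self v k = refl

  contains-punchIn-self₂ : ∀ (v : Fin (suc n)) a T → contains a v (punchInTriple v T) ≡ false
  contains-punchIn-self₂ v a (i , j , k)
    rewrite ==ᵇ-punchIn-self v i | ==ᵇ-punchIn-self v j | ==ᵇ-punchIn-self v k = ∧-zeroʳ _

  weightOf-deleted-pair : ∀ {f : Weight n} → IsFracTriDecomp n f → ∀ (u : Fin (suc n)) {a b} → a Fin.< b →
                          u ≢ a → u ≢ b → weightOf (contains a b ∘ punchInTriple u) f ≡ 1ℚ
  weightOf-deleted-pair {f = f} (_ , pairs) u {a} {b} a<b u≢a u≢b = trans (weightOf-cong restrict f) (pairs a′ b′ a′<b′)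
    where
      a′ = punchOut u≢a
      b′ = punchOut u≢b
      a′<b′ : a′ Fin.< b′
      a′<b′ = Equivalence.from (punchIn-<⇔ u) (subst₂ Fin._<_ (sym (punchIn-punchOut u≢a)) (sym (punchIn-punchOut u≢b)) a<b)
      restrict : ∀ T → contains a b (punchInTriple u T) ≡ contains a′ b′ T
      restrict T = subst₂ (λ x y → contains x y (punchInTriple u T) ≡ contains a′ b′ T)
        (punchIn-punchOut u≢a) (punchIn-punchOut u≢b) (contains-punchIn u a′ b′ T)

  punchIn₂-avoids : ∀ {a b : Fin (suc (suc n))} (a≢b : a ≢ b) i → punchIn₂ a≢b i ≢ a × punchIn₂ a≢b i ≢ b
  punchIn₂-avoids {a = a} a≢b i =
    punchInᵢ≢i a _ ,
    λ u≡b → punchInᵢ≢i (punchOut a≢b) i (punchIn-injective a _ _ (trans u≡b (sym (punchIn-punchOut a≢b))))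

  module _ {m : ℕ} where

    1/[1+m] : ℚ
    1/[1+m] = (+ 1) / suc m

    instance
      1/[1+m]-nonNeg : NonNegative 1/[1+m]
      1/[1+m]-nonNeg = normalize-nonNeg 1 (suc m)

    1/[1+m]*count≡1 : 1/[1+m] * ∑[ i ∈ allFin (suc m) ] 1ℚ ≡ 1ℚ
    1/[1+m]*count≡1 =
      trans (cong (1/[1+m] *_) (trans (∑-allFin-const (suc m) 1ℚ) (*-identityʳ _))) ([a/1+n]*[1+n]≡a 1 m)

    -- Each pair of vertices survives in exactly suc m = r − 1 of the 3 + m = r + 1 deletions.
    average : (Fin (3 ℕ.+ m) → Weight (2 ℕ.+ m)) → Weight (3 ℕ.+ m)
    average fs T = 1/[1+m] * ∑[ v ∈ allFin (3 ℕ.+ m) ] extendByZero v (fs v) T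

    weightOf-average : ∀ (Q : Triple (3 ℕ.+ m) → Bool) fs →
                       weightOf Q (average fs) ≡ 1/[1+m] * ∑[ v ∈ allFin (3 ℕ.+ m) ] weightOf (Q ∘ punchInTriple v) (fs v)
    weightOf-average Q fs = begin
      weightOf Q (average fs)
        ≡⟨ weightOf-∑ Q (average fs) ⟩
      ∑[ T ∈ triples (3 ℕ.+ m) ] (if Q T then 1/[1+m] * ∑[ v ∈ vertices ] e v T else 0ℚ)
        ≡⟨ ∑-cong (triples (3 ℕ.+ m)) (λ T → restrict-∑ (Q T)) ⟩
      ∑[ T ∈ triples (3 ℕ.+ m) ] (1/[1+m] * ∑[ v ∈ vertices ] (if Q T then e v T else 0ℚ))
        ≡⟨ ∑-*ˡ (triples (3 ℕ.+ m)) 1/[1+m] restricted ⟩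
      1/[1+m] * ∑[ T ∈ triples (3 ℕ.+ m) ] ∑[ v ∈ vertices ] (if Q T then e v T else 0ℚ)
        ≡⟨ cong (1/[1+m] *_) (∑-swap (triples (3 ℕ.+ m)) vertices (λ T v → if Q T then e v T else 0ℚ)) ⟩
      1/[1+m] * ∑[ v ∈ vertices ] ∑[ T ∈ triples (3 ℕ.+ m) ] (if Q T then e v T else 0ℚ)
        ≡⟨ cong (1/[1+m] *_) (∑-cong vertices λ v → weightOf-∑ Q (e v)) ⟨
      1/[1+m] * ∑[ v ∈ vertices ] weightOf Q (e v)
        ≡⟨ cong (1/[1+m] *_) (∑-cong vertices λ v → weightOf-extendByZero Q v (fs v)) ⟩
      1/[1+m] * ∑[ v ∈ vertices ] weightOf (Q ∘ punchInTriple v) (fs v) ∎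
      where
        open ≡-Reasoning
        vertices = allFin (3 ℕ.+ m)
        e : Fin (3 ℕ.+ m) → Weight (3 ℕ.+ m)
        e v = extendByZero v (fs v)
        restricted : Triple (3 ℕ.+ m) → ℚ
        restricted T = ∑[ v ∈ vertices ] (if Q T then e v T else 0ℚ)
        restrict-∑ : ∀ b {T} → (if b then 1/[1+m] * ∑[ v ∈ vertices ] e v T else 0ℚ)
                             ≡ 1/[1+m] * ∑[ v ∈ vertices ] (if b then e v T else 0ℚ)
        restrict-∑ true  = refl
        restrict-∑ false = sym (trans (cong (1/[1+m] *_) (∑-zero vertices)) (*-zeroʳ 1/[1+m]))

    average-bounded : ∀ {fs} → (∀ v → Bounded (fs v)) → Bounded (average fs)
    average-bounded {fs} bounded (i , j , k) T∈ = 0≤average , average≤1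
      where
        open ≤-Reasoning
        vertices = allFin (3 ℕ.+ m)
        e : Fin (3 ℕ.+ m) → ℚ
        e v = extendByZero v (fs v) (i , j , k)
        e-bounded : ∀ v → 0ℚ ≤ e v × e v ≤ 1ℚ
        e-bounded v = extendByZero-bounded v (bounded v) (i , j , k) T∈
        i≢j = <⇒≢ (proj₁ (∈-triples⁻ T∈))
        0≤average : 0ℚ ≤ 1/[1+m] * ∑ vertices e
        0≤average = begin
          0ℚ                       ≡⟨ *-zeroʳ 1/[1+m] ⟨
          1/[1+m] * 0ℚ             ≤⟨ *-monoˡ-≤-nonNeg 1/[1+m] (∑-nonNeg vertices λ v _ → proj₁ (e-bounded v)) ⟩
          1/[1+m] * ∑ vertices e   ∎
        average≤1 : 1/[1+m] * ∑ vertices e ≤ 1ℚ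
        average≤1 = begin
          1/[1+m] * ∑ vertices e
            ≡⟨ cong (1/[1+m] *_) (∑-allFin-vanishing₂ (suc m) i≢j e
                 (extendByZero-vanishes₁ i (fs i) j k) (extendByZero-vanishes₂ j (fs j) i k)) ⟩
          1/[1+m] * ∑[ u ∈ allFin (suc m) ] e (punchIn₂ i≢j u)
            ≤⟨ *-monoˡ-≤-nonNeg 1/[1+m] (∑-mono-≤ (allFin (suc m)) λ u _ → proj₂ (e-bounded (punchIn₂ i≢j u))) ⟩
          1/[1+m] * ∑[ u ∈ allFin (suc m) ] 1ℚ
            ≡⟨ 1/[1+m]*count≡1 ⟩
          1ℚ ∎

    average-pairs : ∀ {fs} → (∀ v → IsFracTriDecomp (2 ℕ.+ m) (fs v)) →
                    ∀ a b → a Fin.< b → weightOf (contains a b) (average fs) ≡ 1ℚ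
    average-pairs {fs} decomp a b a<b = begin
      weightOf (contains a b) (average fs)
        ≡⟨ weightOf-average (contains a b) fs ⟩
      1/[1+m] * ∑[ v ∈ allFin (3 ℕ.+ m) ] w v
        ≡⟨ cong (1/[1+m] *_) (∑-allFin-vanishing₂ (suc m) a≢b w wa≡0 wb≡0) ⟩
      1/[1+m] * ∑[ i ∈ allFin (suc m) ] w (punchIn₂ a≢b i)
        ≡⟨ cong (1/[1+m] *_) (∑-cong (allFin (suc m)) λ i →
             weightOf-deleted-pair (decomp _) _ a<b (proj₁ (punchIn₂-avoids a≢b i)) (proj₂ (punchIn₂-avoids a≢b i))) ⟩
      1/[1+m] * ∑[ i ∈ allFin (suc m) ] 1ℚ
        ≡⟨ 1/[1+m]*count≡1 ⟩
      1ℚ ∎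
      where
        open ≡-Reasoning
        w : Fin (3 ℕ.+ m) → ℚ
        w v = weightOf (contains a b ∘ punchInTriple v) (fs v)
        a≢b = <⇒≢ a<b
        wa≡0 = weightOf-false (contains-punchIn-self₁ a b) (fs a)
        wb≡0 = weightOf-false (contains-punchIn-self₂ b a) (fs b)

    average-isFracTriDecomp : ∀ {fs} → (∀ v → IsFracTriDecomp (2 ℕ.+ m) (fs v)) → IsFracTriDecomp (3 ℕ.+ m) (average fs)
    average-isFracTriDecomp decomp = average-bounded (proj₁ ∘ decomp) , average-pairs decomp

    average-large : ∀ (G : Tournament (3 ℕ.+ m)) fs t →
                    (∀ v → t * ((+ suc m) / (3 ℕ.+ m)) ≤ transValue (deleteVertex G v) (fs v)) →
                    t ≤ transValue G (average fs)
    average-large G fs t large = begin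
      t
        ≡⟨ t≡1/[1+m]*∑s ⟩
      1/[1+m] * ∑[ v ∈ vertices ] s
        ≤⟨ *-monoˡ-≤-nonNeg 1/[1+m] (∑-mono-≤ vertices λ v _ → large v) ⟩
      1/[1+m] * ∑[ v ∈ vertices ] transValue (deleteVertex G v) (fs v)
        ≡⟨ weightOf-average (isTransitive G) fs ⟨
      transValue G (average fs) ∎
      where
        open ≤-Reasoning
        vertices = allFin (3 ℕ.+ m)
        q = (+ suc m) / (3 ℕ.+ m)
        s = t * q
        t≡1/[1+m]*∑s : t ≡ 1/[1+m] * ∑[ v ∈ vertices ] s
        t≡1/[1+m]*∑s = sym (begin-equality
          1/[1+m] * ∑[ v ∈ vertices ] s
            ≡⟨ cong (1/[1+m] *_) (∑-allFin-const (3 ℕ.+ m) s) ⟩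
          1/[1+m] * ((+ (3 ℕ.+ m)) / 1 * (t * q))
            ≡⟨ solve 4 (λ c n t q → c :* (n :* (t :* q)) := t :* (c :* (q :* n))) refl 1/[1+m] ((+ (3 ℕ.+ m)) / 1) t q ⟩
          t * (1/[1+m] * (q * ((+ (3 ℕ.+ m)) / 1)))
            ≡⟨ cong (λ x → t * (1/[1+m] * x)) ([a/1+n]*[1+n]≡a (suc m) (2 ℕ.+ m)) ⟩
          t * (1/[1+m] * ((+ suc m) / 1))
            ≡⟨ cong (t *_) ([a/1+n]*[1+n]≡a 1 m) ⟩
          t * 1ℚ
            ≡⟨ *-identityʳ t ⟩
          t ∎)

module LinearProgram where

  open import Defs
  open import Data.Bool using (Bool; true; false; if_then_else_)
  open import Data.Fin as Fin using (Fin)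
  open import Data.Fin.Properties using (_<?_) renaming (_≟_ to _≟ᶠ_)
  open import Data.List using (List; []; _∷_; _++_; filter; concatMap; cartesianProduct; allFin)
  open import Data.List.Membership.Propositional using (_∈_)
  open import Data.List.Membership.Propositional.Properties using (∈-filter⁺; ∈-filter⁻; ∈-cartesianProduct⁺; ∈-allFin)
  open import Data.List.Relation.Unary.All as All using (All; []; _∷_)
  import Data.List.Relation.Unary.All.Properties as All
  open import Data.Nat using (ℕ)
  open import Data.Product using (∃; _×_; _,_; proj₁; proj₂)
  open import Data.Product.Properties using (≡-dec)
  open import Data.Rational using (ℚ; 0ℚ; 1ℚ; _+_; _*_; -_; _≤_; _<_)
  open import Data.Rational.Properties
    using ( module ≤-Reasoning; ≤-antisym; ≤-reflexive; <-≤-trans; ≰⇒>; positive⁻¹; nonNegative⁻¹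
          ; *-identityˡ; *-identityʳ; *-zeroˡ)
  open import Data.Rational.Solver using (module +-*-Solver)
  open import Function using (_⇔_; mk⇔; Equivalence)
  import Function.Properties.Equivalence as ⇔
  open import Relation.Binary.Definitions using (DecidableEquality)
  open import Relation.Binary.PropositionalEquality
  open import Relation.Nullary using (Dec; ¬_; does; yes; no)
  open import Relation.Nullary.Decidable using (map′; dec-true)
  open Equivalence using (to; from)
  open +-*-Solver
  open Sums
  open Triples

  All-concatMap⇔ : ∀ {A B : Set} {P : B → Set} (f : A → List B) xs →
                   All P (concatMap f xs) ⇔ (∀ {y} → y ∈ xs → All P (f y))
  All-concatMap⇔ f xs = mk⇔
    (λ h {y} y∈xs → All.lookup (All.map⁻ (All.concat⁻ h)) y∈xs)
    (λ h → All.concat⁺ (All.map⁺ (All.tabulate λ y∈xs → h y∈xs)))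

  module _ {r : ℕ} where

    _≟ᵗ_ : DecidableEquality (Triple r)
    _≟ᵗ_ = ≡-dec _≟ᶠ_ (≡-dec _≟ᶠ_ _≟ᶠ_)

    open FourierMotzkin _≟ᵗ_

    atLeast atMost : (Triple r → Bool) → ℚ → Form
    atLeast Q b = form (λ T → if Q T then 1ℚ else 0ℚ) (- b)
    atMost Q b = (- 1ℚ) ⊛ atLeast Q b

    eval-atLeast : ∀ Q b x → eval (triples r) (atLeast Q b) x ≡ weightOf Q x + - b
    eval-atLeast Q b x = cong (_+ - b) (trans (∑-cong (triples r) selected) (sym (weightOf-∑ Q x)))
      where
        selected : ∀ T → (if Q T then 1ℚ else 0ℚ) * x T ≡ (if Q T then x T else 0ℚ)
        selected T with Q T
        ... | true  = *-identityˡ (x T)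
        ... | false = *-zeroˡ (x T)

    atLeast-⇔ : ∀ Q b x → 0ℚ ≤ eval (triples r) (atLeast Q b) x ⇔ b ≤ weightOf Q x
    atLeast-⇔ Q b x = subst (λ e → 0ℚ ≤ e ⇔ b ≤ weightOf Q x) (sym (eval-atLeast Q b x)) 0≤p-q⇔q≤p

    atMost-⇔ : ∀ Q b x → 0ℚ ≤ eval (triples r) (atMost Q b) x ⇔ weightOf Q x ≤ b
    atMost-⇔ Q b x = subst (λ e → 0ℚ ≤ e ⇔ weightOf Q x ≤ b) (sym eval-atMost) 0≤p-q⇔q≤p
      where
        eval-atMost : eval (triples r) (atMost Q b) x ≡ b + - weightOf Q x
        eval-atMost = trans (eval-⊛ (triples r) (- 1ℚ) (atLeast Q b) x) (trans (cong (- 1ℚ *_) (eval-atLeast Q b x))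
          (solve 2 (λ w b → :- con 1ℚ :* (w :+ :- b) := b :+ :- w) refl (weightOf Q x) b))

    sameAs : Triple r → Triple r → Bool
    sameAs T T′ = does (T′ ≟ᵗ T)

    -- triples r has no repetitions, but instead of proving it the bounds on x T are scaled by the
    -- number of occurrences of T.
    multiplicity : Triple r → ℚ
    multiplicity T = weightOf (sameAs T) (λ _ → 1ℚ)

    weightOf-sameAs : ∀ T x → weightOf (sameAs T) x ≡ multiplicity T * x T
    weightOf-sameAs T x = begin
      weightOf (sameAs T) x                                   ≡⟨ weightOf-∑ (sameAs T) x ⟩
      ∑[ T′ ∈ triples r ] (if sameAs T T′ then x T′ else 0ℚ)  ≡⟨ ∑-cong (triples r) at-T ⟩
      ∑[ T′ ∈ triples r ] (indicator T′ * x T)                ≡⟨ ∑-*ʳ (triples r) indicator (x T) ⟩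
      ∑ (triples r) indicator * x T                           ≡⟨ cong (_* x T) (weightOf-∑ (sameAs T) (λ _ → 1ℚ)) ⟨
      multiplicity T * x T                                    ∎
      where
        open ≡-Reasoning
        indicator : Triple r → ℚ
        indicator T′ = if sameAs T T′ then 1ℚ else 0ℚ
        at-T : ∀ T′ → (if sameAs T T′ then x T′ else 0ℚ) ≡ indicator T′ * x T
        at-T T′ with T′ ≟ᵗ T
        ... | yes refl = sym (*-identityˡ (x T))
        ... | no _     = sym (*-zeroˡ (x T))

    multiplicity-pos : ∀ {T} → T ∈ triples r → 0ℚ < multiplicity T
    multiplicity-pos {T} T∈ = <-≤-trans (positive⁻¹ 1ℚ) (begin
      1ℚ                             ≡⟨ indicator-T ⟨
      indicator T                    ≤⟨ ∈⇒≤∑ indicator indicator≥0 T∈ ⟩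
      ∑ (triples r) indicator        ≡⟨ weightOf-∑ (sameAs T) (λ _ → 1ℚ) ⟨
      multiplicity T                 ∎)
      where
        open ≤-Reasoning
        indicator : Triple r → ℚ
        indicator T′ = if sameAs T T′ then 1ℚ else 0ℚ
        indicator≥0 : ∀ T′ → 0ℚ ≤ indicator T′
        indicator≥0 T′ with sameAs T T′
        ... | true  = nonNegative⁻¹ 1ℚ
        ... | false = ≤-reflexive refl
        indicator-T : indicator T ≡ 1ℚ
        indicator-T rewrite dec-true (T ≟ᵗ T) refl = refl

    boundForms : Triple r → List Form
    boundForms T = atLeast (sameAs T) 0ℚ ∷ atMost (sameAs T) (multiplicity T) ∷ []

    boundForms-⇔ : ∀ {T} x → T ∈ triples r → Satisfies (triples r) (boundForms T) x ⇔ (0ℚ ≤ x T × x T ≤ 1ℚ)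
    boundForms-⇔ {T} x T∈ = mk⇔
      (λ { (lower ∷ upper ∷ []) → to nonNeg⇔ lower , to atMostOne⇔ upper })
      (λ (0≤xT , xT≤1) → from nonNeg⇔ 0≤xT ∷ from atMostOne⇔ xT≤1 ∷ [])
      where
        m>0 = multiplicity-pos T∈
        nonNeg⇔ : 0ℚ ≤ eval (triples r) (atLeast (sameAs T) 0ℚ) x ⇔ 0ℚ ≤ x T
        nonNeg⇔ = ⇔.trans (atLeast-⇔ (sameAs T) 0ℚ x) (⇔.sym (0≤-rescale m>0 (sym (weightOf-sameAs T x))))
        atMostOne⇔ : 0ℚ ≤ eval (triples r) (atMost (sameAs T) (multiplicity T)) x ⇔ x T ≤ 1ℚ
        atMostOne⇔ = ⇔.trans (atMost-⇔ (sameAs T) (multiplicity T) x)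
          (⇔.sym (subst₂ (λ a b → x T ≤ 1ℚ ⇔ a ≤ b) (sym (weightOf-sameAs T x)) (*-identityʳ _) (*-monoˡ-≤-⇔ m>0)))

    orderedPair? : ∀ (p : Fin r × Fin r) → Dec (proj₁ p Fin.< proj₂ p)
    orderedPair? (a , b) = a <? b

    orderedPairs : List (Fin r × Fin r)
    orderedPairs = filter orderedPair? (cartesianProduct (allFin r) (allFin r))

    ∈-orderedPairs : ∀ {a b} → (a , b) ∈ orderedPairs ⇔ a Fin.< b
    ∈-orderedPairs {a} {b} = mk⇔
      (λ p∈ → proj₂ (∈-filter⁻ orderedPair? {xs = cartesianProduct (allFin r) (allFin r)} p∈))
      (∈-filter⁺ orderedPair? (∈-cartesianProduct⁺ (∈-allFin a) (∈-allFin b)))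

    pairForms : Fin r × Fin r → List Form
    pairForms (a , b) = atLeast (contains a b) 1ℚ ∷ atMost (contains a b) 1ℚ ∷ []

    pairForms-⇔ : ∀ a b x → Satisfies (triples r) (pairForms (a , b)) x ⇔ weightOf (contains a b) x ≡ 1ℚ
    pairForms-⇔ a b x = mk⇔
      (λ { (lower ∷ upper ∷ []) → ≤-antisym (to atMost⇔ upper) (to atLeast⇔ lower) })
      (λ w≡1 → from atLeast⇔ (≤-reflexive (sym w≡1)) ∷ from atMost⇔ (≤-reflexive w≡1) ∷ [])
      where
        atLeast⇔ = atLeast-⇔ (contains a b) 1ℚ x
        atMost⇔ = atMost-⇔ (contains a b) 1ℚ x

    constraints : Tournament r → ℚ → List Form
    constraints H s =
      concatMap boundForms (triples r) ++ concatMap pairForms orderedPairs ++ atLeast (isTransitive H) s ∷ []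

    constraints-⇔ : ∀ H s x → Satisfies (triples r) (constraints H s) x ⇔ (IsFracTriDecomp r x × s ≤ transValue H x)
    constraints-⇔ H s x = mk⇔ sound complete
      where
        sound : Satisfies (triples r) (constraints H s) x → IsFracTriDecomp r x × s ≤ transValue H x
        sound sat with All.++⁻ (concatMap boundForms (triples r)) sat
        ... | bounds , rest with All.++⁻ (concatMap pairForms orderedPairs) rest
        ...   | pairs , large ∷ [] =
          ( (λ T T∈ → to (boundForms-⇔ x T∈) (to (All-concatMap⇔ boundForms (triples r)) bounds T∈))
          , (λ a b a<b → to (pairForms-⇔ a b x)
                            (to (All-concatMap⇔ pairForms orderedPairs) pairs (from ∈-orderedPairs a<b))) )
          , to (atLeast-⇔ (isTransitive H) s x) large
        complete : IsFracTriDecomp r x × s ≤ transValue H x → Satisfies (triples r) (constraints H s) x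
        complete ((bounded , pairs) , large) =
          All.++⁺ (from (All-concatMap⇔ boundForms (triples r)) λ T∈ → from (boundForms-⇔ x T∈) (bounded _ T∈))
            (All.++⁺ (from (All-concatMap⇔ pairForms orderedPairs) λ {(a , b)} p∈ →
                        from (pairForms-⇔ a b x) (pairs a b (to ∈-orderedPairs p∈)))
              (from (atLeast-⇔ (isTransitive H) s x) large ∷ []))

    LargeDecomposition : Tournament r → ℚ → Set
    LargeDecomposition H s = ∃ λ f → IsFracTriDecomp r f × s ≤ transValue H f

    largeDecomposition? : ∀ H s → Dec (LargeDecomposition H s)
    largeDecomposition? H s = map′
      (λ (x , sat) → x , to (constraints-⇔ H s x) sat)
      (λ (f , large) → f , from (constraints-⇔ H s f) large)
      (feasible? (triples r) (constraints H s))

    ¬LargeDecomposition⇒DStar< : ∀ H s → ¬ LargeDecomposition H s → DStar<_ H s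
    ¬LargeDecomposition⇒DStar< H s ¬large f decomp = ≰⇒> (λ s≤ → ¬large (f , decomp , s≤))

open import Defs
open import Data.Nat using (ℕ; suc; _≤_; _∸_)
open import Data.Product using (Σ; _×_)
open import Data.Integer using (+_)
open import Data.Rational using (ℚ; _*_; _/_)

open import Data.Fin using (Fin)
open import Data.Fin.Properties using (all?; ¬∀⟶∃¬)
open import Data.Nat using (zero; _+_; s≤s)
open import Data.Product using (∃; _,_; proj₁; proj₂)
open import Data.Rational.Properties using (<-irrefl; ≤-<-trans)
open import Function using (_∘_)
open import Relation.Binary.PropositionalEquality using (refl)
open import Relation.Nullary using (Dec; yes; no; contradiction)
open VertexDeletion
open LinearProgram

DStar<-someDeletion : ∀ m t (G : Tournament (3 + m)) → DStar<_ G t →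
                      ∃ λ v → DStar<_ (deleteVertex G v) (t * ((+ suc m) / (3 + m)))
DStar<-someDeletion m t G D*<t = decide (all? large?)
  where
    s = t * ((+ suc m) / (3 + m))
    Large : Fin (3 + m) → Set
    Large v = LargeDecomposition (deleteVertex G v) s
    large? : ∀ v → Dec (Large v)
    large? v = largeDecomposition? (deleteVertex G v) s
    decide : Dec (∀ v → Large v) → ∃ λ v → DStar<_ (deleteVertex G v) s
    decide (yes allLarge) = contradiction
      (≤-<-trans (average-large G fs t (proj₂ ∘ proj₂ ∘ allLarge))
                 (D*<t (average fs) (average-isFracTriDecomp {fs = fs} (proj₁ ∘ proj₂ ∘ allLarge))))
      (<-irrefl refl)
      where
        fs : Fin (3 + m) → Weight (2 + m)
        fs = proj₁ ∘ allLarge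
    decide (no ¬allLarge) =
      let (v , ¬large) = ¬∀⟶∃¬ (3 + m) Large large? ¬allLarge
      in v , ¬LargeDecomposition⇒DStar< (deleteVertex G v) s ¬large

lemma3p3 : (r : ℕ) → 3 ≤ r → (t : ℚ) → (G : Tournament (suc r)) →
    DStar<_ G t →
    Σ (Tournament r) λ G' → IsExtensionOf G G' × DStar<_ G' (t * ((+ (r ∸ 1)) / (suc r)))
lemma3p3 zero          ()
lemma3p3 (suc zero)    (s≤s ())
lemma3p3 (suc (suc m)) _ t G D*<t =
  let (v , D*<) = DStar<-someDeletion m t G D*<t
  in deleteVertex G v , deleteVertex-isExtension G v , D*<
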